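{- Let $p$ be an odd prime, $m\ge1$, $q=p^m$, and let $\gamma_1,\gamma_2\in GF(q^2)\setminus\{0\}$ with $\gamma_1\bar\gamma_2-\bar\gamma_1\gamma_2\ne0$. Let \[ \kappa:=\frac{1}{\gamma_1\bar\gamma_1\gamma_2\bar\gamma_2}(\gamma_1\bar\gamma_2+\bar\gamma_1\gamma_2)^2\in GF(q) \] (the capacitance of $B^2_{(\gamma_1,0)}$ and $B^2_{(\gamma_2,0)}$). Then $\frac{\bar\gamma_2}{\bar\gamma_1}$ is a square in $GF(q^2)$ if and only if either $\kappa=0$ and $-1$ is a nonsquare in $GF(q)$, or $\kappa\ne0$ is a square in $GF(q)$.
   Context: $GF(q^2)$ is the quadratic extension of $GF(q)$ and $\bar z:=z^q$ for $z\in GF(q^2)$. $B^2_{(c,0)}$ denotes the circle $\{z\in GF(q^2):\bar c z+c\bar z=0\}\cup\{\infty\}$ of the Möbius plane $\mathbb M(q)$. -}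

module Defs where

open import Level using (0ℓ)
open import Data.Nat using (ℕ; zero; suc)
open import Data.Fin using (Fin)
open import Data.Product using (∃)
open import Relation.Nullary using (¬_)
open import Relation.Binary.PropositionalEquality using (_≡_)
open import Function.Bundles using (_↔_)
open import Algebra.Bundles using (CommutativeRing)

-- The ring equality is required
-- to be propositional equality, so that the bijection with Fin n really
-- counts elements.  _⁻¹ is a total inverse operation (value at 0 irrelevant).
record FiniteField (n : ℕ) : Set₁ where
  field
    commRing : CommutativeRing 0ℓ 0ℓ
  open CommutativeRing commRing public
  field
    ≈⇒≡      : ∀ {x y} → x ≈ y → x ≡ y
    0≢1      : ¬ (0# ≡ 1#)
    _⁻¹      : Carrier → Carrier
    inverseʳ : ∀ x → ¬ (x ≡ 0#) → x * (x ⁻¹) ≡ 1#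
    card     : Carrier ↔ Fin n

  pow : Carrier → ℕ → Carrier
  pow x zero    = 1#
  pow x (suc k) = x * pow x k

module GFq² (q : ℕ) (F : FiniteField (q Data.Nat.* q)) where
  open FiniteField F

  conj : Carrier → Carrier
  conj z = pow z q

  InGFq : Carrier → Set
  InGFq z = conj z ≡ z

  IsSquare : Carrier → Set
  IsSquare x = ∃ λ y → y * y ≡ x

  IsSquareGFq : Carrier → Set
  IsSquareGFq x = ∃ λ y → InGFq y Data.Product.× (y * y ≡ x)

  κ : Carrier → Carrier → Carrier
  κ γ₁ γ₂ =
    (((γ₁ * conj γ₂) + (conj γ₁ * γ₂)) * ((γ₁ * conj γ₂) + (conj γ₁ * γ₂)))
      * ((γ₁ * conj γ₁ * γ₂ * conj γ₂) ⁻¹)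

-- Put u = γ₁γ̄₂, N z = z z̄ and Tr z = z + z̄, so that γ̄₂/γ̄₁ = u / N γ₁ and κ = (Tr u)² / N u.
-- Euler's criterion in GF(q²), proved by pairing each y ≠ 0 with x/y in the product of all
-- nonzero elements, says that z ≠ 0 is a square iff z^h = 1 with h = (q² − 1)/2.  Since
-- z^h = (N z)^((q−1)/2), every element of GF(q)* is a square in GF(q²), and γ̄₂/γ̄₁ is a square
-- iff (N u)^((q−1)/2) = 1.  If Tr u = 0 then ū = −u, so N u = −u² and
-- (N u)^((q−1)/2) = −(−1)^((q−1)/2), which is 1 iff −1 is a nonsquare in GF(q).  Otherwise
-- κ ∈ GF(q)* and κ^((q−1)/2) = ((N u)^((q−1)/2))⁻¹, and Euler's criterion in GF(q) finishes.

module Submission where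

open import Defs
open import Algebra.Bundles using (CommutativeMonoid)
import Algebra.Properties.CommutativeMonoid.Sum as CommutativeMonoidSum
import Algebra.Properties.CommutativeSemigroup as CommutativeSemigroupProperties
import Algebra.Properties.CommutativeSemiring.Binomial as CommutativeSemiringBinomial
import Algebra.Properties.CommutativeSemiring.Exp as CommutativeSemiringExp
import Algebra.Properties.Ring as RingProperties
import Algebra.Properties.Semiring.Exp as SemiringExp
import Algebra.Properties.Semiring.Mult as SemiringMult
open import Data.Fin as Fin using (Fin)
import Data.Fin.Properties as Fin
open import Data.List using (List; []; _∷_; _++_; foldr; length; map; allFin)
open import Data.List.Membership.Propositional using (_∈_; _∉_; lose)
open import Data.List.Membership.Propositional.Properties using (∈-∃++; ∈-map⁺; ∈-allFin)
open import Data.List.Properties using (length-map; length-tabulate)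
open import Data.List.Relation.Binary.Permutation.Propositional
  using (_↭_; ↭-refl; ↭-sym; ↭⇒↭ₛ; ↭⇒↭ₛ′)
open import Data.List.Relation.Binary.Permutation.Propositional.Properties
  using (∈-resp-↭; ↭-length; shift)
import Data.List.Relation.Binary.Permutation.Setoid.Properties as PermutationProperties
open import Data.List.Relation.Unary.All.Properties using (All¬⇒¬Any)
open import Data.List.Relation.Unary.AllPairs using (_∷_)
open import Data.List.Relation.Unary.Any using (here; there; any?; satisfied)
open import Data.List.Relation.Unary.Unique.Propositional using (Unique)
import Data.List.Relation.Unary.Unique.Propositional.Properties as Unique
open import Data.Nat as ℕ using (ℕ; zero; suc; _<_; _!; NonZero; NonTrivial; s≤s)
open import Data.Nat.Combinatorics as Combinatorics using (_C_; nCk≡n!/k![n-k]!; k![n∸k]!∣n!)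
open import Data.Nat.DivMod using (m/n*n≡m; _%_; _/_; m%n<n; m≡m%n+[m/n]*n)
open import Data.Nat.Divisibility using (_∣_; divides; ∣1⇒≡1; ∣⇒≤; ∣m⇒∣m*n; ∣-refl)
open import Data.Nat.Induction using (<-wellFounded)
open import Data.Nat.Primality
  using (Prime; euclidsLemma; prime⇒nonZero; prime⇒nonTrivial; prime⇒irreducible)
import Data.Nat.Properties as ℕ
open import Data.Nat.Tactic.RingSolver using (solve-∀)
open import Data.Product using (∃; _×_; _,_; proj₁; proj₂; map₂)
open import Data.Sum using (_⊎_; inj₁; inj₂; [_,_])
open import Function using (_∘_; id; _↔_; _⇔_; mk⇔; Inverse; Injection; Equivalence; mk↔ₛ′)
import Function.Properties.Equivalence as ⇔
open import Function.Properties.Inverse using (↔⇒↣; ↔-sym; ↔-trans)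
open import Induction.WellFounded using (Acc; acc)
open import Level using (_⊔_)
open import Relation.Binary.Definitions using (DecidableEquality)
open import Relation.Binary.PropositionalEquality
  using (_≡_; _≢_; refl; sym; trans; cong; cong₂; subst; module ≡-Reasoning)
import Relation.Binary.PropositionalEquality as ≡
open import Relation.Nullary using (¬_; Dec; yes; no; contradiction)
open import Relation.Nullary.Decidable using (via-injection)

module _ {a b c} {A : Set a} {B : Set b} {C : Set c} where

  ⊎-select₁ : A → ((A × B) ⊎ (¬ A × C)) ⇔ B
  ⊎-select₁ a = mk⇔ [ proj₂ , (λ (¬a , _) → contradiction a ¬a) ] (λ b → inj₁ (a , b))

  ⊎-select₂ : ¬ A → ((A × B) ⊎ (¬ A × C)) ⇔ C
  ⊎-select₂ ¬a = mk⇔ [ (λ (a , _) → contradiction a ¬a) , proj₂ ] (λ c → inj₂ (¬a , c))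

module _ {a} {A : Set a} where

  trans-⇔ : ∀ {x y z : A} → x ≡ y → (y ≡ z) ⇔ (x ≡ z)
  trans-⇔ x≡y = mk⇔ (trans x≡y) (trans (sym x≡y))

  ∈⇒↭∷ : ∀ {v : A} {xs} → v ∈ xs → ∃ λ ys → xs ↭ v ∷ ys
  ∈⇒↭∷ v∈xs with as , bs , refl ← ∈-∃++ v∈xs = as ++ bs , shift _ as bs

  module _ {v : A} {xs ys} (xs↭v∷ys : xs ↭ v ∷ ys) where

    ∈-↭∷⁺ : ∀ {z} → z ∈ ys → z ∈ xs
    ∈-↭∷⁺ = ∈-resp-↭ (↭-sym xs↭v∷ys) ∘ there

    ∈-↭∷⁻ : ∀ {z} → z ∈ xs → z ≢ v → z ∈ ys
    ∈-↭∷⁻ z∈xs z≢v with ∈-resp-↭ xs↭v∷ys z∈xs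
    ... | here z≡v   = contradiction z≡v z≢v
    ... | there z∈ys = z∈ys

    Unique-↭∷ : Unique xs → v ∉ ys × Unique ys
    Unique-↭∷ u with v≢ys ∷ u′ ← PermutationProperties.Unique-resp-↭ (≡.setoid A) (↭⇒↭ₛ xs↭v∷ys) u
      = All¬⇒¬Any v≢ys , u′

module Pairing {m ℓ} (M : CommutativeMonoid m ℓ) where

  open CommutativeMonoid M hiding (refl; sym; trans)
  private module M = CommutativeMonoid M
  open import Algebra.Definitions.RawMonoid rawMonoid using () renaming (_×_ to _times_)
  open import Relation.Binary.Reasoning.Setoid setoid

  infixr 8 _^_
  _^_ : Carrier → ℕ → Carrier
  x ^ n = n times x

  product : List Carrier → Carrier
  product = foldr _∙_ ε

  product-↭ : ∀ {xs ys} → xs ↭ ys → product xs ≈ product ys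
  product-↭ p = PermutationProperties.foldr-commMonoid setoid isCommutativeMonoid (↭⇒↭ₛ′ isEquivalence p)

  module _ (τ : Carrier → Carrier) (c : Carrier) where

    PairedBy : List Carrier → Set (m ⊔ ℓ)
    PairedBy xs = ∀ {y} → y ∈ xs → τ y ∈ xs × τ (τ y) ≡ y × τ y ≢ y × y ∙ τ y ≈ c

    remove-pair : ∀ {y ys} → Unique (y ∷ ys) → PairedBy (y ∷ ys) →
                  ∃ λ zs → ys ↭ τ y ∷ zs × Unique zs × PairedBy zs
    remove-pair {y} {ys} (y≢ys ∷ u) paired
      with τy∈y∷ys , ττy≡y , τy≢y , _ ← paired (here refl)
      with zs , ys↭τy∷zs ← ∈⇒↭∷ (∈-↭∷⁻ ↭-refl τy∈y∷ys τy≢y)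
      with τy∉zs , u′ ← Unique-↭∷ ys↭τy∷zs u
      = zs , ys↭τy∷zs , u′ , paired′
      where
      paired′ : PairedBy zs
      paired′ {z} z∈zs
        with τz∈y∷ys , ττz≡z , τz≢z , zτz≈c ← paired (there (∈-↭∷⁺ ys↭τy∷zs z∈zs))
        = ∈-↭∷⁻ ys↭τy∷zs (∈-↭∷⁻ ↭-refl τz∈y∷ys τz≢y) τz≢τy , ττz≡z , τz≢z , zτz≈c
        where
        τz≢y : τ z ≢ y
        τz≢y τz≡y = τy∉zs (subst (_∈ zs) (trans (sym ττz≡z) (cong τ τz≡y)) z∈zs)
        τz≢τy : τ z ≢ τ y
        τz≢τy τz≡τy = All¬⇒¬Any y≢ys
          (subst (_∈ ys) (trans (sym ττz≡z) (trans (cong τ τz≡τy) ττy≡y)) (∈-↭∷⁺ ys↭τy∷zs z∈zs))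

    product-pairs : ∀ xs → Unique xs → PairedBy xs → ∃ λ j → length xs ≡ 2 ℕ.* j × product xs ≈ c ^ j
    product-pairs xs = go xs (<-wellFounded (length xs))
      where
      go : ∀ xs → Acc _<_ (length xs) → Unique xs → PairedBy xs →
           ∃ λ j → length xs ≡ 2 ℕ.* j × product xs ≈ c ^ j
      go [] _ _ _ = 0 , refl , M.refl
      go (y ∷ ys) (acc rec) u paired
        with _ , _ , _ , yτy≈c ← paired (here refl)
        with zs , ys↭τy∷zs , u′ , paired′ ← remove-pair u paired
        with j , ∣zs∣≡2j , Πzs≈cʲ ←
               go zs (rec (ℕ.m<n⇒m<1+n (ℕ.≤-reflexive (sym (↭-length ys↭τy∷zs))))) u′ paired′
        = suc j , length-eq , product-eq
        where
        length-eq : suc (length ys) ≡ 2 ℕ.* suc j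
        length-eq = trans (cong suc (trans (↭-length ys↭τy∷zs) (cong suc ∣zs∣≡2j))) (sym (ℕ.*-suc 2 j))
        product-eq : y ∙ product ys ≈ c ^ suc j
        product-eq = begin
          y ∙ product ys            ≈⟨ ∙-congˡ (product-↭ ys↭τy∷zs) ⟩
          y ∙ (τ y ∙ product zs)    ≈⟨ assoc y (τ y) (product zs) ⟨
          (y ∙ τ y) ∙ product zs    ≈⟨ ∙-cong yτy≈c Πzs≈cʲ ⟩
          c ∙ c ^ j                 ∎

-- Arithmetic of an odd prime

module _ {p} (p-prime : Prime p) where

  private instance
    p-nonZero : NonZero p
    p-nonZero = prime⇒nonZero p-prime
    p-nonTrivial : NonTrivial p
    p-nonTrivial = prime⇒nonTrivial p-prime

  prime∤! : ∀ {j} → j < p → ¬ p ∣ j !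
  prime∤! {zero}  j<p p∣1 = contradiction (∣1⇒≡1 p∣1) ℕ.nonTrivial⇒≢1
  prime∤! {suc j} j<p p∣[1+j]*j! with euclidsLemma (suc j) (j !) p-prime p∣[1+j]*j!
  ... | inj₁ p∣1+j = ℕ.<-irrefl refl (ℕ.≤-<-trans (∣⇒≤ p∣1+j) j<p)
  ... | inj₂ p∣j!  = prime∤! (ℕ.<-trans (ℕ.n<1+n j) j<p) p∣j!

  prime∣choose : ∀ {k} → 0 < k → k < p → p ∣ p C k
  prime∣choose {k} 0<k k<p with euclidsLemma (p C k) (k ! ℕ.* (p ℕ.∸ k) !) p-prime p∣pCk*k!*[p-k]!
    where
    instance _ = k ℕ.!* (p ℕ.∸ k) !≢0
    pCk*k!*[p-k]!≡p! : (p C k) ℕ.* (k ! ℕ.* (p ℕ.∸ k) !) ≡ p !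
    pCk*k!*[p-k]!≡p! = trans (cong (ℕ._* (k ! ℕ.* (p ℕ.∸ k) !)) (nCk≡n!/k![n-k]! (ℕ.<⇒≤ k<p)))
                              (m/n*n≡m (k![n∸k]!∣n! (ℕ.<⇒≤ k<p)))
    m∣m! : ∀ {m} .{{_ : NonZero m}} → m ∣ m !
    m∣m! {suc m} = ∣m⇒∣m*n (m !) ∣-refl
    p∣pCk*k!*[p-k]! : p ∣ (p C k) ℕ.* (k ! ℕ.* (p ℕ.∸ k) !)
    p∣pCk*k!*[p-k]! = subst (p ∣_) (sym pCk*k!*[p-k]!≡p!) m∣m!
  ... | inj₁ p∣pCk = p∣pCk
  ... | inj₂ p∣k!*[p-k]! with euclidsLemma (k !) ((p ℕ.∸ k) !) p-prime p∣k!*[p-k]!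
  ... | inj₁ p∣k!      = contradiction p∣k! (prime∤! k<p)
  ... | inj₂ p∣[p-k]!  = contradiction p∣[p-k]! (prime∤! (ℕ.∸-monoʳ-< 0<k (ℕ.<⇒≤ k<p)))

odd-prime : ∀ {p} → Prime p → p ≢ 2 → ∃ λ k → p ≡ suc (2 ℕ.* k)
odd-prime {p} p-prime p≢2 with p % 2 | m%n<n p 2 | m≡m%n+[m/n]*n p 2
... | 0 | _ | p≡[p/2]*2 with prime⇒irreducible p-prime (divides (p / 2) p≡[p/2]*2)
...   | inj₂ 2≡p = contradiction (sym 2≡p) p≢2
odd-prime {p} p-prime p≢2 | 1 | _ | p≡1+[p/2]*2 = p / 2 , trans p≡1+[p/2]*2 (cong suc (ℕ.*-comm (p / 2) 2))
odd-prime {p} p-prime p≢2 | suc (suc _) | s≤s (s≤s ()) | _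

odd-* : ∀ i j → suc (2 ℕ.* i) ℕ.* suc (2 ℕ.* j) ≡ suc (2 ℕ.* (i ℕ.+ j ℕ.+ 2 ℕ.* i ℕ.* j))
odd-* = solve-∀

odd-^ : ∀ k m → ∃ λ r → suc (2 ℕ.* k) ℕ.^ m ≡ suc (2 ℕ.* r)
odd-^ k zero = 0 , refl
odd-^ k (suc m) with r , eq ← odd-^ k m =
  k ℕ.+ r ℕ.+ 2 ℕ.* k ℕ.* r , trans (cong (suc (2 ℕ.* k) ℕ.*_) eq) (odd-* k r)

odd-square : ∀ r → suc (2 ℕ.* r) ℕ.* suc (2 ℕ.* r) ≡ suc (2 ℕ.* (r ℕ.* suc (suc (2 ℕ.* r))))
odd-square = solve-∀

-- Finite fields

module FiniteFieldProperties {n : ℕ} (F : FiniteField n) where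

  private module F = FiniteField F
  open FiniteField F public using (Carrier; _+_; _*_; -_; 0#; 1#; _⁻¹; inverseʳ)
  open FiniteField F using (≈⇒≡; pow; ring; semiring; commutativeSemiring)
  open SemiringExp semiring public using (_^_)
  open SemiringMult semiring public using () renaming (_×_ to _·_)
  private
    module R = RingProperties ring
    module E = SemiringExp semiring
    module CE = CommutativeSemiringExp commutativeSemiring
    module M = SemiringMult semiring
    module CS = CommutativeSemigroupProperties F.*-commutativeSemigroup
    module Σ = CommutativeMonoidSum F.+-commutativeMonoid
    module B = CommutativeSemiringBinomial commutativeSemiring

  +-comm : ∀ x y → x + y ≡ y + x
  +-comm x y = ≈⇒≡ (F.+-comm x y)

  +-assoc : ∀ x y z → (x + y) + z ≡ x + (y + z)
  +-assoc x y z = ≈⇒≡ (F.+-assoc x y z)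

  +-identityˡ : ∀ x → 0# + x ≡ x
  +-identityˡ x = ≈⇒≡ (F.+-identityˡ x)

  +-identityʳ : ∀ x → x + 0# ≡ x
  +-identityʳ x = ≈⇒≡ (F.+-identityʳ x)

  -‿inverseˡ : ∀ x → - x + x ≡ 0#
  -‿inverseˡ x = ≈⇒≡ (F.-‿inverseˡ x)

  -‿inverseʳ : ∀ x → x + - x ≡ 0#
  -‿inverseʳ x = ≈⇒≡ (F.-‿inverseʳ x)

  *-comm : ∀ x y → x * y ≡ y * x
  *-comm x y = ≈⇒≡ (F.*-comm x y)

  *-assoc : ∀ x y z → (x * y) * z ≡ x * (y * z)
  *-assoc x y z = ≈⇒≡ (F.*-assoc x y z)

  *-interchange : ∀ a b c d → (a * b) * (c * d) ≡ (a * c) * (b * d)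
  *-interchange a b c d = ≈⇒≡ (CS.interchange a b c d)

  *-identityˡ : ∀ x → 1# * x ≡ x
  *-identityˡ x = ≈⇒≡ (F.*-identityˡ x)

  *-identityʳ : ∀ x → x * 1# ≡ x
  *-identityʳ x = ≈⇒≡ (F.*-identityʳ x)

  zeroˡ : ∀ x → 0# * x ≡ 0#
  zeroˡ x = ≈⇒≡ (F.zeroˡ x)

  zeroʳ : ∀ x → x * 0# ≡ 0#
  zeroʳ x = ≈⇒≡ (F.zeroʳ x)

  distribˡ : ∀ x y z → x * (y + z) ≡ x * y + x * z
  distribˡ x y z = ≈⇒≡ (F.distribˡ x y z)

  distribʳ : ∀ x y z → (y + z) * x ≡ y * x + z * x
  distribʳ x y z = ≈⇒≡ (F.distribʳ x y z)

  -‿distribˡ-* : ∀ x y → - (x * y) ≡ - x * y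
  -‿distribˡ-* x y = ≈⇒≡ (R.-‿distribˡ-* x y)

  -‿distribʳ-* : ∀ x y → - (x * y) ≡ x * - y
  -‿distribʳ-* x y = ≈⇒≡ (R.-‿distribʳ-* x y)

  -‿involutive : ∀ x → - - x ≡ x
  -‿involutive x = ≈⇒≡ (R.-‿involutive x)

  -1*x≡-x : ∀ x → - 1# * x ≡ - x
  -1*x≡-x x = ≈⇒≡ (R.-1*x≈-x x)

  -x*-y≡x*y : ∀ x y → - x * - y ≡ x * y
  -x*-y≡x*y x y = trans (sym (-‿distribˡ-* x (- y))) (trans (cong -_ (sym (-‿distribʳ-* x y))) (-‿involutive (x * y)))

  x+y≡0⇒x≡-y : ∀ x y → x + y ≡ 0# → x ≡ - y
  x+y≡0⇒x≡-y x y x+y≡0 = ≈⇒≡ (R.+-inverseˡ-unique x y (F.reflexive x+y≡0))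

  1≢0 : 1# ≢ 0#
  1≢0 = F.0≢1 ∘ sym

  -x≢0 : ∀ {x} → x ≢ 0# → - x ≢ 0#
  -x≢0 {x} x≢0 -x≡0 = x≢0 (trans (sym (-‿involutive x)) (trans (cong -_ -x≡0) (≈⇒≡ R.-0#≈0#)))

  _≟_ : DecidableEquality Carrier
  _≟_ = via-injection (↔⇒↣ F.card) Fin._≟_

  inverseˡ : ∀ {x} → x ≢ 0# → x ⁻¹ * x ≡ 1#
  inverseˡ {x} x≢0 = trans (*-comm (x ⁻¹) x) (inverseʳ x x≢0)

  x⁻¹*[x*y]≡y : ∀ {x} y → x ≢ 0# → x ⁻¹ * (x * y) ≡ y
  x⁻¹*[x*y]≡y {x} y x≢0 = begin
    x ⁻¹ * (x * y)  ≡⟨ *-assoc (x ⁻¹) x y ⟨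
    (x ⁻¹ * x) * y  ≡⟨ cong (_* y) (inverseˡ x≢0) ⟩
    1# * y          ≡⟨ *-identityˡ y ⟩
    y               ∎
    where open ≡-Reasoning

  y*z≡x⇒x*z⁻¹≡y : ∀ {x y z} → y * z ≡ x → z ≢ 0# → x * z ⁻¹ ≡ y
  y*z≡x⇒x*z⁻¹≡y {x} {y} {z} y*z≡x z≢0 = begin
    x * z ⁻¹        ≡⟨ cong (_* z ⁻¹) y*z≡x ⟨
    (y * z) * z ⁻¹  ≡⟨ *-assoc y z (z ⁻¹) ⟩
    y * (z * z ⁻¹)  ≡⟨ cong (y *_) (inverseʳ z z≢0) ⟩
    y * 1#          ≡⟨ *-identityʳ y ⟩
    y               ∎
    where open ≡-Reasoning

  *-cancelˡ : ∀ {x y z} → x ≢ 0# → x * y ≡ x * z → y ≡ z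
  *-cancelˡ {x} {y} {z} x≢0 x*y≡x*z =
    trans (sym (x⁻¹*[x*y]≡y y x≢0)) (trans (cong (x ⁻¹ *_) x*y≡x*z) (x⁻¹*[x*y]≡y z x≢0))

  x*y≡0⇒x≡0⊎y≡0 : ∀ {x y} → x * y ≡ 0# → x ≡ 0# ⊎ y ≡ 0#
  x*y≡0⇒x≡0⊎y≡0 {x} {y} x*y≡0 with x ≟ 0#
  ... | yes x≡0 = inj₁ x≡0
  ... | no x≢0  = inj₂ (*-cancelˡ x≢0 (trans x*y≡0 (sym (zeroʳ x))))

  *-≢0 : ∀ {x y} → x ≢ 0# → y ≢ 0# → x * y ≢ 0#
  *-≢0 x≢0 y≢0 x*y≡0 with x*y≡0⇒x≡0⊎y≡0 x*y≡0
  ... | inj₁ x≡0 = x≢0 x≡0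
  ... | inj₂ y≡0 = y≢0 y≡0

  x*y≡1⇒x≢0 : ∀ {x y} → x * y ≡ 1# → x ≢ 0#
  x*y≡1⇒x≢0 {x} {y} x*y≡1 x≡0 = 1≢0 (trans (sym x*y≡1) (trans (cong (_* y) x≡0) (zeroˡ y)))

  x*x≢0⇒x≢0 : ∀ {x} → x * x ≢ 0# → x ≢ 0#
  x*x≢0⇒x≢0 {x} x*x≢0 x≡0 = x*x≢0 (trans (cong (_* x) x≡0) (zeroˡ x))

  ⁻¹-unique : ∀ {x y} → x * y ≡ 1# → y ≡ x ⁻¹
  ⁻¹-unique {x} x*y≡1 = *-cancelˡ x≢0 (trans x*y≡1 (sym (inverseʳ x x≢0)))
    where x≢0 = x*y≡1⇒x≢0 x*y≡1

  ⁻¹-≢0 : ∀ {x} → x ≢ 0# → x ⁻¹ ≢ 0#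
  ⁻¹-≢0 x≢0 = x*y≡1⇒x≢0 (inverseˡ x≢0)

  ⁻¹-involutive : ∀ {x} → x ≢ 0# → x ⁻¹ ⁻¹ ≡ x
  ⁻¹-involutive x≢0 = sym (⁻¹-unique (inverseˡ x≢0))

  1⁻¹≡1 : 1# ⁻¹ ≡ 1#
  1⁻¹≡1 = sym (⁻¹-unique (*-identityˡ 1#))

  ⁻¹≡1⇔≡1 : ∀ {x} → x ≢ 0# → x ⁻¹ ≡ 1# ⇔ x ≡ 1#
  ⁻¹≡1⇔≡1 {x} x≢0 = mk⇔ (λ x⁻¹≡1 → trans (sym (⁻¹-involutive x≢0)) (trans (cong _⁻¹ x⁻¹≡1) 1⁻¹≡1))
                        (λ x≡1 → trans (cong _⁻¹ x≡1) 1⁻¹≡1)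

  ⁻¹-distrib-* : ∀ {x y} → x ≢ 0# → y ≢ 0# → (x * y) ⁻¹ ≡ x ⁻¹ * y ⁻¹
  ⁻¹-distrib-* {x} {y} x≢0 y≢0 = sym (⁻¹-unique (begin
    (x * y) * (x ⁻¹ * y ⁻¹)    ≡⟨ *-interchange x y (x ⁻¹) (y ⁻¹) ⟩
    (x * x ⁻¹) * (y * y ⁻¹)    ≡⟨ cong₂ _*_ (inverseʳ x x≢0) (inverseʳ y y≢0) ⟩
    1# * 1#                    ≡⟨ *-identityˡ 1# ⟩
    1#                         ∎))
    where open ≡-Reasoning

  difference-of-squares : ∀ x y → (x + - y) * (x + y) ≡ x * x + - (y * y)
  difference-of-squares x y = begin
    (x + - y) * (x + y)                       ≡⟨ distribʳ (x + y) x (- y) ⟩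
    x * (x + y) + - y * (x + y)               ≡⟨ cong₂ _+_ (distribˡ x x y) (distribˡ (- y) x y) ⟩
    (x * x + x * y) + (- y * x + - y * y)     ≡⟨ cong (λ t → (x * x + x * y) + (t + - y * y)) -y*x≡-[x*y] ⟩
    (x * x + x * y) + (- (x * y) + - y * y)   ≡⟨ +-assoc (x * x) (x * y) _ ⟩
    x * x + (x * y + (- (x * y) + - y * y))   ≡⟨ cong (x * x +_) (+-assoc (x * y) (- (x * y)) (- y * y)) ⟨
    x * x + ((x * y + - (x * y)) + - y * y)   ≡⟨ cong (λ t → x * x + (t + - y * y)) (-‿inverseʳ (x * y)) ⟩
    x * x + (0# + - y * y)                    ≡⟨ cong (x * x +_) (trans (+-identityˡ (- y * y)) (sym (-‿distribˡ-* y y))) ⟩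
    x * x + - (y * y)                         ∎
    where
    open ≡-Reasoning
    -y*x≡-[x*y] : - y * x ≡ - (x * y)
    -y*x≡-[x*y] = trans (sym (-‿distribˡ-* y x)) (cong -_ (*-comm y x))

  x*x≡y*y⇒x≡y⊎x≡-y : ∀ {x y} → x * x ≡ y * y → x ≡ y ⊎ x ≡ - y
  x*x≡y*y⇒x≡y⊎x≡-y {x} {y} x*x≡y*y
    with x*y≡0⇒x≡0⊎y≡0 (trans (difference-of-squares x y)
                              (trans (cong (_+ - (y * y)) x*x≡y*y) (-‿inverseʳ (y * y))))
  ... | inj₁ x-y≡0 = inj₁ (trans (x+y≡0⇒x≡-y x (- y) x-y≡0) (-‿involutive y))
  ... | inj₂ x+y≡0 = inj₂ (x+y≡0⇒x≡-y x y x+y≡0)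

  -x≢x : 1# + 1# ≢ 0# → ∀ {x} → x ≢ 0# → - x ≢ x
  -x≢x 1+1≢0 {x} x≢0 -x≡x with x*y≡0⇒x≡0⊎y≡0 [1+1]*x≡0
    where
    open ≡-Reasoning
    [1+1]*x≡0 : (1# + 1#) * x ≡ 0#
    [1+1]*x≡0 = begin
      (1# + 1#) * x    ≡⟨ distribʳ x 1# 1# ⟩
      1# * x + 1# * x  ≡⟨ cong₂ _+_ (*-identityˡ x) (trans (*-identityˡ x) (sym -x≡x)) ⟩
      x + - x          ≡⟨ -‿inverseʳ x ⟩
      0#               ∎
  ... | inj₁ 1+1≡0 = 1+1≢0 1+1≡0
  ... | inj₂ x≡0   = x≢0 x≡0

  pow≡^ : ∀ x k → pow x k ≡ x ^ k
  pow≡^ x zero    = refl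
  pow≡^ x (suc k) = cong (x *_) (pow≡^ x k)

  ^-homo-* : ∀ x m n → x ^ (m ℕ.+ n) ≡ x ^ m * x ^ n
  ^-homo-* x m n = ≈⇒≡ (E.^-homo-* x m n)

  ^-assocʳ : ∀ x m n → (x ^ m) ^ n ≡ x ^ (m ℕ.* n)
  ^-assocʳ x m n = ≈⇒≡ (E.^-assocʳ x m n)

  ^-distrib-* : ∀ x y k → (x * y) ^ k ≡ x ^ k * y ^ k
  ^-distrib-* x y k = ≈⇒≡ (CE.^-distrib-* x y k)

  ^-double : ∀ x k → x ^ (2 ℕ.* k) ≡ x ^ k * x ^ k
  ^-double x k = trans (cong (λ i → x ^ (k ℕ.+ i)) (ℕ.+-identityʳ k)) (^-homo-* x k k)

  [x*x]^k≡x^2k : ∀ x k → (x * x) ^ k ≡ x ^ (2 ℕ.* k)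
  [x*x]^k≡x^2k x k = trans (^-distrib-* x x k) (sym (^-double x k))

  1^k≡1 : ∀ k → 1# ^ k ≡ 1#
  1^k≡1 zero    = refl
  1^k≡1 (suc k) = trans (*-identityˡ (1# ^ k)) (1^k≡1 k)

  ^-≢0 : ∀ {x} k → x ≢ 0# → x ^ k ≢ 0#
  ^-≢0 zero    x≢0 = 1≢0
  ^-≢0 (suc k) x≢0 = *-≢0 x≢0 (^-≢0 k x≢0)

  ^≡0⇒≡0 : ∀ {x} k → x ^ k ≡ 0# → x ≡ 0#
  ^≡0⇒≡0 {x} k x^k≡0 with x ≟ 0#
  ... | yes x≡0 = x≡0
  ... | no x≢0  = contradiction x^k≡0 (^-≢0 k x≢0)

  ⁻¹-^ : ∀ {x} k → x ≢ 0# → x ⁻¹ ^ k ≡ (x ^ k) ⁻¹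
  ⁻¹-^ {x} k x≢0 = ⁻¹-unique (begin
    x ^ k * x ⁻¹ ^ k  ≡⟨ ^-distrib-* x (x ⁻¹) k ⟨
    (x * x ⁻¹) ^ k    ≡⟨ cong (_^ k) (inverseʳ x x≢0) ⟩
    1# ^ k            ≡⟨ 1^k≡1 k ⟩
    1#                ∎)
    where open ≡-Reasoning

  elements : List Carrier
  elements = map (Inverse.from F.card) (allFin n)

  elements-unique : Unique elements
  elements-unique = Unique.map⁺ (Injection.injective (↔⇒↣ (↔-sym F.card))) (Unique.allFin⁺ n)

  ∈-elements : ∀ x → x ∈ elements
  ∈-elements x = subst (_∈ elements) (Inverse.strictlyInverseʳ F.card x) (∈-map⁺ _ (∈-allFin _))

  length-elements : length elements ≡ n
  length-elements = trans (length-map _ (allFin n)) (length-tabulate id)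

  IsSquare? : ∀ x → Dec (∃ λ y → y * y ≡ x)
  IsSquare? x with any? (λ y → (y * y) ≟ x) elements
  ... | yes y*y≡x = yes (satisfied y*y≡x)
  ... | no ¬y*y≡x = no λ (y , y*y≡x) → ¬y*y≡x (lose (∈-elements y) y*y≡x)

  -- Summing a + x over all x permutes the summands, so n · a + Σ x = Σ x.
  n·a≡0 : ∀ a → n · a ≡ 0#
  n·a≡0 a = ≈⇒≡ (R.+-identityˡ-unique (n · a) (Σ.sum {n} element) (F.reflexive (begin
    n · a + Σ.sum element                             ≡⟨ cong (_+ Σ.sum element) (≈⇒≡ (Σ.sum-replicate n)) ⟨
    Σ.sum {n} (λ _ → a) + Σ.sum element               ≡⟨ ≈⇒≡ (Σ.∑-distrib-+ (λ _ → a) element) ⟨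
    Σ.sum (λ i → a + element i)
      ≡⟨ Σ.sum-cong-≗ (λ i → sym (Inverse.strictlyInverseʳ F.card (a + element i))) ⟩
    Σ.sum (λ i → element (Inverse.to translation i))  ≡⟨ ≈⇒≡ (Σ.sum-permute element translation) ⟨
    Σ.sum {n} element                                 ∎)))
    where
    open ≡-Reasoning
    element : Fin n → Carrier
    element = Inverse.from F.card
    a+[-a+x]≡x : ∀ x → a + (- a + x) ≡ x
    a+[-a+x]≡x x = trans (sym (+-assoc a (- a) x)) (trans (cong (_+ x) (-‿inverseʳ a)) (+-identityˡ x))
    -a+[a+x]≡x : ∀ x → - a + (a + x) ≡ x
    -a+[a+x]≡x x = trans (sym (+-assoc (- a) a x)) (trans (cong (_+ x) (-‿inverseˡ a)) (+-identityˡ x))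
    translation : Fin n ↔ Fin n
    translation = ↔-trans (↔-sym F.card) (↔-trans (mk↔ₛ′ (a +_) (- a +_) a+[-a+x]≡x -a+[a+x]≡x) F.card)

  ^·1≡·1^ : ∀ p k → (p ℕ.^ k) · 1# ≡ (p · 1#) ^ k
  ^·1≡·1^ p zero    = +-identityʳ 1#
  ^·1≡·1^ p (suc k) = trans (≈⇒≡ (M.×1-homo-* p (p ℕ.^ k))) (cong ((p · 1#) *_) (^·1≡·1^ p k))

  prime-power-characteristic : ∀ p k → n ≡ p ℕ.^ k → p · 1# ≡ 0#
  prime-power-characteristic p k n≡p^k =
    ^≡0⇒≡0 k (trans (sym (^·1≡·1^ p k)) (trans (cong (_· 1#) (sym n≡p^k)) (n·a≡0 1#)))

  odd-characteristic : ∀ {h} → n ≡ suc (2 ℕ.* h) → 1# + 1# ≢ 0#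
  odd-characteristic {h} n≡1+2h 1+1≡0 = 1≢0 (begin
    1#                           ≡⟨ +-identityʳ 1# ⟨
    1# + 0#                      ≡⟨ cong (1# +_) 2h·1≡0 ⟨
    suc (2 ℕ.* h) · 1#           ≡⟨ cong (_· 1#) n≡1+2h ⟨
    n · 1#                       ≡⟨ n·a≡0 1# ⟩
    0#                           ∎)
    where
    open ≡-Reasoning
    2h·1≡0 : (2 ℕ.* h) · 1# ≡ 0#
    2h·1≡0 = begin
      (2 ℕ.* h) · 1#             ≡⟨ ≈⇒≡ (M.×1-homo-* 2 h) ⟩
      (1# + (1# + 0#)) * h · 1#  ≡⟨ cong (λ t → (1# + t) * h · 1#) (+-identityʳ 1#) ⟩
      (1# + 1#) * h · 1#         ≡⟨ cong (_* h · 1#) 1+1≡0 ⟩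
      0# * h · 1#                ≡⟨ zeroˡ (h · 1#) ⟩
      0#                         ∎

  ·0≡0 : ∀ c → c · 0# ≡ 0#
  ·0≡0 zero    = refl
  ·0≡0 (suc c) = trans (+-identityˡ (c · 0#)) (·0≡0 c)

  ∣⇒·≡0 : ∀ {p c} → p · 1# ≡ 0# → p ∣ c → ∀ x → c · x ≡ 0#
  ∣⇒·≡0 {p} p·1≡0 (divides c refl) x = begin
    (c ℕ.* p) · x     ≡⟨ ≈⇒≡ (M.×-assocˡ x c p) ⟨
    c · (p · x)       ≡⟨ cong (λ t → c · (p · t)) (*-identityˡ x) ⟨
    c · (p · (1# * x)) ≡⟨ cong (c ·_) (≈⇒≡ (M.×-assoc-* p 1# x)) ⟨
    c · ((p · 1#) * x) ≡⟨ cong (λ t → c · (t * x)) p·1≡0 ⟩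
    c · (0# * x)      ≡⟨ cong (c ·_) (zeroˡ x) ⟩
    c · 0#            ≡⟨ ·0≡0 c ⟩
    0#                ∎
    where open ≡-Reasoning

  frobenius-+ : ∀ {p} → Prime p → p · 1# ≡ 0# → ∀ x y → (x + y) ^ p ≡ x ^ p + y ^ p
  frobenius-+ {suc p} p-prime p·1≡0 x y = begin
    (x + y) ^ suc p                                       ≡⟨ ≈⇒≡ (B.theorem (suc p) x y) ⟩
    term Fin.zero + Σ.sum (term ∘ Fin.suc)               ≡⟨ cong (term Fin.zero +_) (≈⇒≡ (Σ.sum-init-last (term ∘ Fin.suc))) ⟩
    term Fin.zero + (Σ.sum (term ∘ Fin.suc ∘ Fin.inject₁) + term (Fin.suc (Fin.fromℕ p)))
      ≡⟨ cong₂ (λ s t → term Fin.zero + (s + t)) middle-terms≡0 last-term ⟩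
    term Fin.zero + (0# + x ^ suc p)                      ≡⟨ cong₂ _+_ first-term (+-identityˡ (x ^ suc p)) ⟩
    y ^ suc p + x ^ suc p                                 ≡⟨ +-comm (y ^ suc p) (x ^ suc p) ⟩
    x ^ suc p + y ^ suc p                                 ∎
    where
    open ≡-Reasoning
    term = B.binomialTerm x y (suc p)
    first-term : term Fin.zero ≡ y ^ suc p
    first-term = trans (≈⇒≡ (M.×-homo-1 _)) (*-identityˡ (y ^ suc p))
    last-term : term (Fin.suc (Fin.fromℕ p)) ≡ x ^ suc p
    last-term rewrite Fin.toℕ-fromℕ p | Combinatorics.nCn≡1 (suc p) | ℕ.n∸n≡0 p
      = trans (≈⇒≡ (M.×-homo-1 _)) (*-identityʳ (x ^ suc p))
    middle-term≡0 : ∀ i → term (Fin.suc (Fin.inject₁ i)) ≡ 0#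
    middle-term≡0 i rewrite Fin.toℕ-inject₁ i =
      ∣⇒·≡0 p·1≡0 (prime∣choose p-prime (s≤s ℕ.z≤n) (s≤s (Fin.toℕ<n i))) _
    middle-terms≡0 : Σ.sum (term ∘ Fin.suc ∘ Fin.inject₁) ≡ 0#
    middle-terms≡0 = trans (Σ.sum-cong-≗ middle-term≡0) (≈⇒≡ (Σ.sum-replicate-zero p))

  frobenius-^-+ : ∀ {p} → Prime p → p · 1# ≡ 0# → ∀ k x y →
                  (x + y) ^ (p ℕ.^ k) ≡ x ^ (p ℕ.^ k) + y ^ (p ℕ.^ k)
  frobenius-^-+ p-prime p·1≡0 zero x y = trans (*-identityʳ (x + y)) (sym (cong₂ _+_ (*-identityʳ x) (*-identityʳ y)))
  frobenius-^-+ {p} p-prime p·1≡0 (suc k) x y = begin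
    (x + y) ^ (p ℕ.* p ℕ.^ k)                    ≡⟨ ^-assocʳ (x + y) p (p ℕ.^ k) ⟨
    ((x + y) ^ p) ^ (p ℕ.^ k)                    ≡⟨ cong (_^ (p ℕ.^ k)) (frobenius-+ p-prime p·1≡0 x y) ⟩
    (x ^ p + y ^ p) ^ (p ℕ.^ k)                  ≡⟨ frobenius-^-+ p-prime p·1≡0 k (x ^ p) (y ^ p) ⟩
    (x ^ p) ^ (p ℕ.^ k) + (y ^ p) ^ (p ℕ.^ k)    ≡⟨ cong₂ _+_ (^-assocʳ x p (p ℕ.^ k)) (^-assocʳ y p (p ℕ.^ k)) ⟩
    x ^ (p ℕ.* p ℕ.^ k) + y ^ (p ℕ.* p ℕ.^ k)    ∎
    where open ≡-Reasoning

  open Pairing F.*-commutativeMonoid using (product; product-↭; PairedBy; product-pairs)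

  nonzeros : List Carrier
  nonzeros = proj₁ (∈⇒↭∷ (∈-elements 0#))

  elements↭0∷nonzeros : elements ↭ 0# ∷ nonzeros
  elements↭0∷nonzeros = proj₂ (∈⇒↭∷ (∈-elements 0#))

  nonzeros-unique : Unique nonzeros
  nonzeros-unique = proj₂ (Unique-↭∷ elements↭0∷nonzeros elements-unique)

  ∈-nonzeros⁺ : ∀ {x} → x ≢ 0# → x ∈ nonzeros
  ∈-nonzeros⁺ {x} = ∈-↭∷⁻ elements↭0∷nonzeros (∈-elements x)

  ∈-nonzeros⁻ : ∀ {x} → x ∈ nonzeros → x ≢ 0#
  ∈-nonzeros⁻ x∈nonzeros refl = proj₁ (Unique-↭∷ elements↭0∷nonzeros elements-unique) x∈nonzeros

  n≡1+∣nonzeros∣ : n ≡ suc (length nonzeros)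
  n≡1+∣nonzeros∣ = trans (sym length-elements) (↭-length elements↭0∷nonzeros)

  module Partner {x} (x≢0 : x ≢ 0#) where

    partner : Carrier → Carrier
    partner y = x * y ⁻¹

    partner-≢0 : ∀ {y} → y ≢ 0# → partner y ≢ 0#
    partner-≢0 y≢0 = *-≢0 x≢0 (⁻¹-≢0 y≢0)

    *-partner : ∀ {y} → y ≢ 0# → y * partner y ≡ x
    *-partner {y} y≢0 = begin
      y * (x * y ⁻¹)  ≡⟨ *-assoc y x (y ⁻¹) ⟨
      (y * x) * y ⁻¹  ≡⟨ cong (_* y ⁻¹) (*-comm y x) ⟩
      (x * y) * y ⁻¹  ≡⟨ y*z≡x⇒x*z⁻¹≡y refl y≢0 ⟩
      x               ∎
      where open ≡-Reasoning

    partner-involutive : ∀ {y} → y ≢ 0# → partner (partner y) ≡ y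
    partner-involutive y≢0 = y*z≡x⇒x*z⁻¹≡y (*-partner y≢0) (partner-≢0 y≢0)

    partner-fixed⇒square : ∀ {y} → y ≢ 0# → partner y ≡ y → y * y ≡ x
    partner-fixed⇒square {y} y≢0 partner-y≡y = trans (cong (y *_) (sym partner-y≡y)) (*-partner y≢0)

    square⇒partner-fixed : ∀ {y} → y * y ≡ x → partner y ≡ y
    square⇒partner-fixed y*y≡x = y*z≡x⇒x*z⁻¹≡y y*y≡x (x*x≢0⇒x≢0 (subst (_≢ 0#) (sym y*y≡x) x≢0))

    paired : ∀ {ys} → (∀ {y} → y ∈ ys → y ≢ 0# × partner y ∈ ys × partner y ≢ y) → PairedBy partner x ys
    paired closed y∈ys with y≢0 , partner-y∈ys , partner-y≢y ← closed y∈ys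
      = partner-y∈ys , partner-involutive y≢0 , partner-y≢y , F.reflexive (*-partner y≢0)

  product-nonzeros-nonsquare : ∀ {x} → x ≢ 0# → ¬ (∃ λ y → y * y ≡ x) →
                               ∃ λ j → length nonzeros ≡ 2 ℕ.* j × product nonzeros ≡ x ^ j
  product-nonzeros-nonsquare {x} x≢0 nonsquare =
    map₂ (map₂ ≈⇒≡) (product-pairs partner x nonzeros nonzeros-unique (paired closed))
    where
    open Partner x≢0
    closed : ∀ {y} → y ∈ nonzeros → y ≢ 0# × partner y ∈ nonzeros × partner y ≢ y
    closed y∈nonzeros =
      y≢0 , ∈-nonzeros⁺ (partner-≢0 y≢0) , λ fixed → nonsquare (_ , partner-fixed⇒square y≢0 fixed)
      where y≢0 = ∈-nonzeros⁻ y∈nonzeros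

  module _ (1+1≢0 : 1# + 1# ≢ 0#) {y} (y≢0 : y ≢ 0#) {ys zs}
           (nonzeros↭y∷ys : nonzeros ↭ y ∷ ys) (ys↭-y∷zs : ys ↭ - y ∷ zs) where

    open Partner (*-≢0 y≢0 y≢0)

    private
      ys-unique = Unique-↭∷ nonzeros↭y∷ys nonzeros-unique
      zs-unique = Unique-↭∷ ys↭-y∷zs (proj₂ ys-unique)

      ∈-zs⁻ : ∀ {z} → z ∈ zs → z ∈ nonzeros × z ≢ y × z ≢ - y
      ∈-zs⁻ z∈zs = ∈-↭∷⁺ nonzeros↭y∷ys z∈ys
                 , (λ z≡y → proj₁ ys-unique (subst (_∈ ys) z≡y z∈ys))
                 , (λ z≡-y → proj₁ zs-unique (subst (_∈ zs) z≡-y z∈zs))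
        where z∈ys = ∈-↭∷⁺ ys↭-y∷zs z∈zs

      ∈-zs⁺ : ∀ {z} → z ∈ nonzeros → z ≢ y → z ≢ - y → z ∈ zs
      ∈-zs⁺ z∈nonzeros z≢y = ∈-↭∷⁻ ys↭-y∷zs (∈-↭∷⁻ nonzeros↭y∷ys z∈nonzeros z≢y)

    nonzeros-without-±-paired : Unique zs × PairedBy partner (y * y) zs
    nonzeros-without-±-paired = proj₂ zs-unique , paired closed
      where
      closed : ∀ {z} → z ∈ zs → z ≢ 0# × partner z ∈ zs × partner z ≢ z
      closed {z} z∈zs with z∈nonzeros , z≢y , z≢-y ← ∈-zs⁻ z∈zs
        = z≢0 , ∈-zs⁺ (∈-nonzeros⁺ (partner-≢0 z≢0)) partner-z≢y partner-z≢-y , partner-z≢z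
        where
        z≢0 = ∈-nonzeros⁻ z∈nonzeros
        partner-z≢ : ∀ {v} → v * v ≡ y * y → z ≢ v → partner z ≢ v
        partner-z≢ v*v≡y*y z≢v partner-z≡v =
          z≢v (trans (sym (partner-involutive z≢0)) (trans (cong partner partner-z≡v) (square⇒partner-fixed v*v≡y*y)))
        partner-z≢y  = partner-z≢ refl z≢y
        partner-z≢-y = partner-z≢ (-x*-y≡x*y y y) z≢-y
        partner-z≢z : partner z ≢ z
        partner-z≢z fixed with x*x≡y*y⇒x≡y⊎x≡-y (partner-fixed⇒square z≢0 fixed)
        ... | inj₁ z≡y  = z≢y z≡y
        ... | inj₂ z≡-y = z≢-y z≡-y

  product-nonzeros-square : 1# + 1# ≢ 0# → ∀ {y} → y ≢ 0# →
                            ∃ λ j → length nonzeros ≡ 2 ℕ.* suc j × product nonzeros ≡ - ((y * y) ^ suc j)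
  product-nonzeros-square 1+1≢0 {y} y≢0
    with ys , nonzeros↭y∷ys ← ∈⇒↭∷ (∈-nonzeros⁺ y≢0)
    with zs , ys↭-y∷zs ← ∈⇒↭∷ (∈-↭∷⁻ nonzeros↭y∷ys (∈-nonzeros⁺ (-x≢0 y≢0)) (-x≢x 1+1≢0 y≢0))
    with zs-unique , zs-paired ← nonzeros-without-±-paired 1+1≢0 y≢0 nonzeros↭y∷ys ys↭-y∷zs
    with j , ∣zs∣≡2j , Πzs≈ ← product-pairs (Partner.partner (*-≢0 y≢0 y≢0)) (y * y) zs zs-unique zs-paired
    = j , length-eq , product-eq
    where
    length-eq : length nonzeros ≡ 2 ℕ.* suc j
    length-eq = trans (↭-length nonzeros↭y∷ys)
                      (trans (cong suc (trans (↭-length ys↭-y∷zs) (cong suc ∣zs∣≡2j))) (sym (ℕ.*-suc 2 j)))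

    product-eq : product nonzeros ≡ - ((y * y) ^ suc j)
    product-eq = begin
      product nonzeros                     ≡⟨ ≈⇒≡ (product-↭ nonzeros↭y∷ys) ⟩
      y * product ys                       ≡⟨ cong (y *_) (≈⇒≡ (product-↭ ys↭-y∷zs)) ⟩
      y * (- y * product zs)               ≡⟨ *-assoc y (- y) (product zs) ⟨
      (y * - y) * product zs               ≡⟨ cong₂ _*_ (sym (-‿distribʳ-* y y)) (≈⇒≡ Πzs≈) ⟩
      - (y * y) * (y * y) ^ j              ≡⟨ -‿distribˡ-* (y * y) ((y * y) ^ j) ⟨
      - ((y * y) ^ suc j)                  ∎
      where open ≡-Reasoning

  module EulerCriterion {h} (n≡1+2h : n ≡ suc (2 ℕ.* h)) where

    private
      1+1≢0 : 1# + 1# ≢ 0#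
      1+1≢0 = odd-characteristic {h} n≡1+2h

      ∣nonzeros∣≡2h : length nonzeros ≡ 2 ℕ.* h
      ∣nonzeros∣≡2h = ℕ.suc-injective (trans (sym n≡1+∣nonzeros∣) n≡1+2h)

    1≢-1 : 1# ≢ - 1#
    1≢-1 1≡-1 = 1+1≢0 (trans (cong (1# +_) 1≡-1) (-‿inverseʳ 1#))

    product-nonzeros≡-square^h : ∀ {y} → y ≢ 0# → product nonzeros ≡ - ((y * y) ^ h)
    product-nonzeros≡-square^h {y} y≢0 =
      let j , ∣nonzeros∣≡2[1+j] , Π≡ = product-nonzeros-square 1+1≢0 y≢0
          1+j≡h = ℕ.*-cancelˡ-≡ (suc j) h 2 (trans (sym ∣nonzeros∣≡2[1+j]) ∣nonzeros∣≡2h)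
      in subst (λ k → product nonzeros ≡ - ((y * y) ^ k)) 1+j≡h Π≡

    product-nonzeros≡nonsquare^h : ∀ {x} → x ≢ 0# → ¬ (∃ λ y → y * y ≡ x) → product nonzeros ≡ x ^ h
    product-nonzeros≡nonsquare^h {x} x≢0 nonsquare =
      let j , ∣nonzeros∣≡2j , Π≡ = product-nonzeros-nonsquare x≢0 nonsquare
          j≡h = ℕ.*-cancelˡ-≡ j h 2 (trans (sym ∣nonzeros∣≡2j) ∣nonzeros∣≡2h)
      in subst (λ k → product nonzeros ≡ x ^ k) j≡h Π≡

    wilson : product nonzeros ≡ - 1#
    wilson = trans (product-nonzeros≡-square^h 1≢0) (cong -_ (trans (cong (_^ h) (*-identityˡ 1#)) (1^k≡1 h)))

    euler-square : ∀ {x} → x ≢ 0# → ∃ (λ y → y * y ≡ x) → x ^ h ≡ 1#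
    euler-square x≢0 (y , refl) =
      ≈⇒≡ (R.-‿injective (F.reflexive (trans (sym (product-nonzeros≡-square^h (x*x≢0⇒x≢0 x≢0))) wilson)))

    euler-nonsquare : ∀ {x} → x ≢ 0# → ¬ ∃ (λ y → y * y ≡ x) → x ^ h ≡ - 1#
    euler-nonsquare x≢0 nonsquare = trans (sym (product-nonzeros≡nonsquare^h x≢0 nonsquare)) wilson

    euler-criterion : ∀ {x} → x ≢ 0# → ∃ (λ y → y * y ≡ x) ⇔ x ^ h ≡ 1#
    euler-criterion {x} x≢0 = mk⇔ (euler-square x≢0) from
      where
      from : x ^ h ≡ 1# → ∃ λ y → y * y ≡ x
      from x^h≡1 with IsSquare? x
      ... | yes square   = square
      ... | no nonsquare = contradiction (trans (sym x^h≡1) (euler-nonsquare x≢0 nonsquare)) 1≢-1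

    fermat : ∀ {x} → x ≢ 0# → x ^ (2 ℕ.* h) ≡ 1#
    fermat {x} x≢0 with IsSquare? x
    ... | yes square   = trans (^-double x h) (trans (cong₂ _*_ x^h≡1 x^h≡1) (*-identityˡ 1#))
      where x^h≡1 = euler-square x≢0 square
    ... | no nonsquare =
      trans (^-double x h) (trans (cong₂ _*_ x^h≡-1 x^h≡-1) (trans (-x*-y≡x*y 1# 1#) (*-identityˡ 1#)))
      where x^h≡-1 = euler-nonsquare x≢0 nonsquare

-- GF(q) inside GF(q²)

module QuadraticExtension {p m} (p-prime : Prime p) (F : FiniteField (p ℕ.^ m ℕ.* p ℕ.^ m))
                          (r : ℕ) (q≡1+2r : p ℕ.^ m ≡ suc (2 ℕ.* r)) where

  open FiniteFieldProperties F
  open GFq² (p ℕ.^ m) F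

  q : ℕ
  q = p ℕ.^ m

  h : ℕ
  h = r ℕ.* suc q

  q*q≡1+2h : q ℕ.* q ≡ suc (2 ℕ.* h)
  q*q≡1+2h = trans (cong (λ t → t ℕ.* t) q≡1+2r)
                   (trans (odd-square r) (cong (λ t → suc (2 ℕ.* (r ℕ.* suc t))) (sym q≡1+2r)))

  open EulerCriterion {h} q*q≡1+2h

  trace : Carrier → Carrier
  trace z = z + conj z

  norm : Carrier → Carrier
  norm z = z * conj z

  capacitance : Carrier → Carrier
  capacitance z = (trace z * trace z) * norm z ⁻¹

  conj≡^ : ∀ x → conj x ≡ x ^ q
  conj≡^ x = pow≡^ x q

  ^q≡*^2r : ∀ x → x ^ q ≡ x * x ^ (2 ℕ.* r)
  ^q≡*^2r x = cong (x ^_) q≡1+2r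

  conj-* : ∀ x y → conj (x * y) ≡ conj x * conj y
  conj-* x y = trans (conj≡^ (x * y)) (trans (^-distrib-* x y q) (sym (cong₂ _*_ (conj≡^ x) (conj≡^ y))))

  conj-+ : ∀ x y → conj (x + y) ≡ conj x + conj y
  conj-+ x y =
    trans (conj≡^ (x + y)) (trans (frobenius-^-+ p-prime p·1≡0 m x y) (sym (cong₂ _+_ (conj≡^ x) (conj≡^ y))))
    where p·1≡0 = prime-power-characteristic p (m ℕ.+ m) (sym (ℕ.^-distribˡ-+-* p m m))

  conj-⁻¹ : ∀ {x} → x ≢ 0# → conj (x ⁻¹) ≡ conj x ⁻¹
  conj-⁻¹ {x} x≢0 = trans (conj≡^ (x ⁻¹)) (trans (⁻¹-^ q x≢0) (cong _⁻¹ (sym (conj≡^ x))))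

  conj-≢0 : ∀ {x} → x ≢ 0# → conj x ≢ 0#
  conj-≢0 {x} x≢0 = subst (_≢ 0#) (sym (conj≡^ x)) (^-≢0 q x≢0)

  conj-involutive : ∀ x → conj (conj x) ≡ x
  conj-involutive x = begin
    conj (conj x)      ≡⟨ trans (conj≡^ (conj x)) (cong (_^ q) (conj≡^ x)) ⟩
    (x ^ q) ^ q        ≡⟨ ^-assocʳ x q q ⟩
    x ^ (q ℕ.* q)      ≡⟨ cong (x ^_) q*q≡1+2h ⟩
    x * x ^ (2 ℕ.* h)  ≡⟨ x*x^2h≡x ⟩
    x                  ∎
    where
    open ≡-Reasoning
    x*x^2h≡x : x * x ^ (2 ℕ.* h) ≡ x
    x*x^2h≡x with x ≟ 0#
    ... | yes x≡0 = trans (cong (_* x ^ (2 ℕ.* h)) x≡0) (trans (zeroˡ _) (sym x≡0))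
    ... | no x≢0  = trans (cong (x *_) (fermat x≢0)) (*-identityʳ x)

  conj≡-⇒^2r≡-1 : ∀ {z} → z ≢ 0# → conj z ≡ - z → z ^ (2 ℕ.* r) ≡ - 1#
  conj≡-⇒^2r≡-1 {z} z≢0 conj-z≡-z = *-cancelˡ z≢0 (begin
    z * z ^ (2 ℕ.* r)  ≡⟨ trans (sym (^q≡*^2r z)) (sym (conj≡^ z)) ⟩
    conj z             ≡⟨ conj-z≡-z ⟩
    - z                ≡⟨ cong -_ (*-identityʳ z) ⟨
    - (z * 1#)         ≡⟨ -‿distribʳ-* z 1# ⟩
    z * - 1#           ∎)
    where open ≡-Reasoning

  norm-≢0 : ∀ {z} → z ≢ 0# → norm z ≢ 0#
  norm-≢0 z≢0 = *-≢0 z≢0 (conj-≢0 z≢0)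

  ^h≡norm^r : ∀ z → z ^ h ≡ norm z ^ r
  ^h≡norm^r z = begin
    z ^ (r ℕ.* suc q)    ≡⟨ cong (z ^_) (ℕ.*-comm r (suc q)) ⟩
    z ^ (suc q ℕ.* r)    ≡⟨ ^-assocʳ z (suc q) r ⟨
    (z * z ^ q) ^ r      ≡⟨ cong (λ t → (z * t) ^ r) (conj≡^ z) ⟨
    (z * conj z) ^ r     ∎
    where open ≡-Reasoning

  InGFq-* : ∀ {x y} → InGFq x → InGFq y → InGFq (x * y)
  InGFq-* {x} {y} x∈GFq y∈GFq = trans (conj-* x y) (cong₂ _*_ x∈GFq y∈GFq)

  InGFq-⁻¹ : ∀ {x} → x ≢ 0# → InGFq x → InGFq (x ⁻¹)
  InGFq-⁻¹ x≢0 x∈GFq = trans (conj-⁻¹ x≢0) (cong _⁻¹ x∈GFq)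

  InGFq--1 : InGFq (- 1#)
  InGFq--1 = begin
    conj (- 1#)                  ≡⟨ trans (conj≡^ (- 1#)) (^q≡*^2r (- 1#)) ⟩
    - 1# * (- 1#) ^ (2 ℕ.* r)    ≡⟨ cong (- 1# *_) ([x*x]^k≡x^2k (- 1#) r) ⟨
    - 1# * (- 1# * - 1#) ^ r     ≡⟨ cong (λ t → - 1# * t ^ r) (trans (-x*-y≡x*y 1# 1#) (*-identityˡ 1#)) ⟩
    - 1# * 1# ^ r                ≡⟨ cong (- 1# *_) (1^k≡1 r) ⟩
    - 1# * 1#                    ≡⟨ *-identityʳ (- 1#) ⟩
    - 1#                         ∎
    where open ≡-Reasoning

  InGFq-trace : ∀ z → InGFq (trace z)
  InGFq-trace z = trans (conj-+ z (conj z)) (trans (cong (conj z +_) (conj-involutive z)) (+-comm (conj z) z))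

  InGFq-norm : ∀ z → InGFq (norm z)
  InGFq-norm z = trans (conj-* z (conj z)) (trans (cong (conj z *_) (conj-involutive z)) (*-comm (conj z) z))

  InGFq-capacitance : ∀ {z} → z ≢ 0# → InGFq (capacitance z)
  InGFq-capacitance {z} z≢0 =
    InGFq-* (InGFq-* (InGFq-trace z) (InGFq-trace z)) (InGFq-⁻¹ (norm-≢0 z≢0) (InGFq-norm z))

  fermat-GFq : ∀ {t} → InGFq t → t ≢ 0# → t ^ (2 ℕ.* r) ≡ 1#
  fermat-GFq {t} t∈GFq t≢0 =
    *-cancelˡ t≢0 (trans (sym (^q≡*^2r t)) (trans (sym (conj≡^ t)) (trans t∈GFq (sym (*-identityʳ t)))))

  ^r≡±1-GFq : ∀ {t} → InGFq t → t ≢ 0# → t ^ r ≡ 1# ⊎ t ^ r ≡ - 1#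
  ^r≡±1-GFq {t} t∈GFq t≢0 =
    x*x≡y*y⇒x≡y⊎x≡-y (trans (sym (^-double t r)) (trans (fermat-GFq t∈GFq t≢0) (sym (*-identityˡ 1#))))

  ^h≡1-GFq : ∀ {t} → InGFq t → t ≢ 0# → t ^ h ≡ 1#
  ^h≡1-GFq {t} t∈GFq t≢0 =
    trans (^h≡norm^r t) (trans (cong (λ s → (t * s) ^ r) t∈GFq) (trans ([x*x]^k≡x^2k t r) (fermat-GFq t∈GFq t≢0)))

  euler-criterion-GFq : ∀ {s} → InGFq s → s ≢ 0# → IsSquareGFq s ⇔ s ^ r ≡ 1#
  euler-criterion-GFq {s} s∈GFq s≢0 = mk⇔ to from
    where
    to : IsSquareGFq s → s ^ r ≡ 1#
    to (t , t∈GFq , refl) = trans ([x*x]^k≡x^2k t r) (fermat-GFq t∈GFq (x*x≢0⇒x≢0 s≢0))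
    from : s ^ r ≡ 1# → IsSquareGFq s
    from s^r≡1 = root-in-GFq (Equivalence.from (euler-criterion s≢0) s^h≡1)
      where
      s^h≡1 : s ^ h ≡ 1#
      s^h≡1 = trans (sym (^-assocʳ s r (suc q))) (trans (cong (_^ suc q) s^r≡1) (1^k≡1 (suc q)))
      root-in-GFq : (∃ λ t → t * t ≡ s) → IsSquareGFq s
      root-in-GFq (t , t*t≡s)
        with x*x≡y*y⇒x≡y⊎x≡-y (trans (sym (conj-* t t)) (trans (cong conj t*t≡s) (trans s∈GFq (sym t*t≡s))))
      ... | inj₁ t∈GFq     = t , t∈GFq , t*t≡s
      ... | inj₂ conj-t≡-t = contradiction (trans (sym s^r≡1) (begin
        s ^ r             ≡⟨ cong (_^ r) t*t≡s ⟨
        (t * t) ^ r       ≡⟨ [x*x]^k≡x^2k t r ⟩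
        t ^ (2 ℕ.* r)     ≡⟨ conj≡-⇒^2r≡-1 (x*x≢0⇒x≢0 (subst (_≢ 0#) (sym t*t≡s) s≢0)) conj-t≡-t ⟩
        - 1#              ∎)) 1≢-1
        where open ≡-Reasoning

  nonsquare-criterion-GFq : ∀ {s} → InGFq s → s ≢ 0# → (¬ IsSquareGFq s) ⇔ s ^ r ≡ - 1#
  nonsquare-criterion-GFq {s} s∈GFq s≢0 = mk⇔ to from
    where
    to : ¬ IsSquareGFq s → s ^ r ≡ - 1#
    to nonsquare with ^r≡±1-GFq s∈GFq s≢0
    ... | inj₁ s^r≡1  = contradiction (Equivalence.from (euler-criterion-GFq s∈GFq s≢0) s^r≡1) nonsquare
    ... | inj₂ s^r≡-1 = s^r≡-1
    from : s ^ r ≡ - 1# → ¬ IsSquareGFq s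
    from s^r≡-1 square = 1≢-1 (trans (sym (Equivalence.to (euler-criterion-GFq s∈GFq s≢0) square)) s^r≡-1)

  square-*⁻¹-GFq⇔ : ∀ {z t} → z ≢ 0# → InGFq t → t ≢ 0# → IsSquare (z * t ⁻¹) ⇔ IsSquare z
  square-*⁻¹-GFq⇔ {z} {t} z≢0 t∈GFq t≢0 =
    ⇔.trans (euler-criterion (*-≢0 z≢0 (⁻¹-≢0 t≢0)))
            (⇔.trans (trans-⇔ (sym [z*t⁻¹]^h≡z^h)) (⇔.sym (euler-criterion z≢0)))
    where
    open ≡-Reasoning
    [z*t⁻¹]^h≡z^h : (z * t ⁻¹) ^ h ≡ z ^ h
    [z*t⁻¹]^h≡z^h = begin
      (z * t ⁻¹) ^ h    ≡⟨ ^-distrib-* z (t ⁻¹) h ⟩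
      z ^ h * t ⁻¹ ^ h  ≡⟨ cong (z ^ h *_) (trans (⁻¹-^ h t≢0) (trans (cong _⁻¹ (^h≡1-GFq t∈GFq t≢0)) 1⁻¹≡1)) ⟩
      z ^ h * 1#        ≡⟨ *-identityʳ (z ^ h) ⟩
      z ^ h             ∎

  square⇔norm^r≡1 : ∀ {z} → z ≢ 0# → IsSquare z ⇔ norm z ^ r ≡ 1#
  square⇔norm^r≡1 {z} z≢0 = ⇔.trans (euler-criterion z≢0) (trans-⇔ (sym (^h≡norm^r z)))

  norm^r≡-[-1]^r : ∀ {z} → z ≢ 0# → trace z ≡ 0# → norm z ^ r ≡ - ((- 1#) ^ r)
  norm^r≡-[-1]^r {z} z≢0 trace≡0 = begin
    (z * conj z) ^ r            ≡⟨ cong (λ t → (z * t) ^ r) conj-z≡-z ⟩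
    (z * - z) ^ r               ≡⟨ cong (_^ r) (trans (sym (-‿distribʳ-* z z)) (sym (-1*x≡-x (z * z)))) ⟩
    (- 1# * (z * z)) ^ r        ≡⟨ ^-distrib-* (- 1#) (z * z) r ⟩
    (- 1#) ^ r * (z * z) ^ r    ≡⟨ cong ((- 1#) ^ r *_) (trans ([x*x]^k≡x^2k z r) (conj≡-⇒^2r≡-1 z≢0 conj-z≡-z)) ⟩
    (- 1#) ^ r * - 1#           ≡⟨ -‿distribʳ-* ((- 1#) ^ r) 1# ⟨
    - ((- 1#) ^ r * 1#)         ≡⟨ cong -_ (*-identityʳ ((- 1#) ^ r)) ⟩
    - ((- 1#) ^ r)              ∎
    where
    open ≡-Reasoning
    conj-z≡-z : conj z ≡ - z
    conj-z≡-z = x+y≡0⇒x≡-y (conj z) z (trans (+-comm (conj z) z) trace≡0)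

  square⇔-when-trace≡0 : ∀ {z} → z ≢ 0# → trace z ≡ 0# → IsSquare z ⇔ (¬ IsSquareGFq (- 1#))
  square⇔-when-trace≡0 {z} z≢0 trace≡0 =
    ⇔.trans (square⇔norm^r≡1 z≢0)
    (⇔.trans (⇔.trans (trans-⇔ (sym (norm^r≡-[-1]^r z≢0 trace≡0))) -x≡1⇔x≡-1)
             (⇔.sym (nonsquare-criterion-GFq InGFq--1 (-x≢0 1≢0))))
    where
    -x≡1⇔x≡-1 : ∀ {x} → - x ≡ 1# ⇔ x ≡ - 1#
    -x≡1⇔x≡-1 {x} = mk⇔ (λ -x≡1 → trans (sym (-‿involutive x)) (cong -_ -x≡1))
                        (λ x≡-1 → trans (cong -_ x≡-1) (-‿involutive 1#))

  capacitance^r≡norm^r⁻¹ : ∀ {z} → z ≢ 0# → trace z ≢ 0# → capacitance z ^ r ≡ (norm z ^ r) ⁻¹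
  capacitance^r≡norm^r⁻¹ {z} z≢0 trace≢0 = begin
    ((trace z * trace z) * norm z ⁻¹) ^ r        ≡⟨ ^-distrib-* (trace z * trace z) (norm z ⁻¹) r ⟩
    (trace z * trace z) ^ r * (norm z ⁻¹) ^ r    ≡⟨ cong₂ _*_ trace²^r≡1 (⁻¹-^ r (norm-≢0 z≢0)) ⟩
    1# * (norm z ^ r) ⁻¹                         ≡⟨ *-identityˡ _ ⟩
    (norm z ^ r) ⁻¹                              ∎
    where
    open ≡-Reasoning
    trace²^r≡1 : (trace z * trace z) ^ r ≡ 1#
    trace²^r≡1 = trans ([x*x]^k≡x^2k (trace z) r) (fermat-GFq (InGFq-trace z) trace≢0)

  square⇔-when-trace≢0 : ∀ {z} → z ≢ 0# → trace z ≢ 0# → IsSquare z ⇔ IsSquareGFq (capacitance z)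
  square⇔-when-trace≢0 {z} z≢0 trace≢0 =
    ⇔.trans (square⇔norm^r≡1 z≢0)
    (⇔.trans (⇔.sym (⁻¹≡1⇔≡1 (^-≢0 r (norm-≢0 z≢0))))
    (⇔.trans (trans-⇔ (capacitance^r≡norm^r⁻¹ z≢0 trace≢0))
             (⇔.sym (euler-criterion-GFq (InGFq-capacitance z≢0) capacitance≢0))))
    where
    capacitance≢0 : capacitance z ≢ 0#
    capacitance≢0 = *-≢0 (*-≢0 trace≢0 trace≢0) (⁻¹-≢0 (norm-≢0 z≢0))

  square⇔capacitance : ∀ {z} → z ≢ 0# →
    IsSquare z ⇔ ((capacitance z ≡ 0# × ¬ IsSquareGFq (- 1#)) ⊎ (capacitance z ≢ 0# × IsSquareGFq (capacitance z)))
  square⇔capacitance {z} z≢0 with trace z ≟ 0#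
  ... | yes trace≡0 = ⇔.trans (square⇔-when-trace≡0 z≢0 trace≡0) (⇔.sym (⊎-select₁ capacitance≡0))
    where
    capacitance≡0 : capacitance z ≡ 0#
    capacitance≡0 =
      trans (cong (λ t → (t * t) * norm z ⁻¹) trace≡0) (trans (cong (_* norm z ⁻¹) (zeroˡ 0#)) (zeroˡ _))
  ... | no trace≢0 = ⇔.trans (square⇔-when-trace≢0 z≢0 trace≢0) (⇔.sym (⊎-select₂ capacitance≢0))
    where
    capacitance≢0 : capacitance z ≢ 0#
    capacitance≢0 = *-≢0 (*-≢0 trace≢0 trace≢0) (⁻¹-≢0 (norm-≢0 z≢0))

  module _ {γ₁ γ₂} (γ₁≢0 : γ₁ ≢ 0#) (γ₂≢0 : γ₂ ≢ 0#) where

    private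
      u = γ₁ * conj γ₂

      conj-u : conj u ≡ conj γ₁ * γ₂
      conj-u = trans (conj-* γ₁ (conj γ₂)) (cong (conj γ₁ *_) (conj-involutive γ₂))

    κ≡capacitance : κ γ₁ γ₂ ≡ capacitance u
    κ≡capacitance = cong₂ (λ w D → (w * w) * D ⁻¹) (cong (u +_) (sym conj-u)) (begin
      γ₁ * conj γ₁ * γ₂ * conj γ₂        ≡⟨ *-assoc (γ₁ * conj γ₁) γ₂ (conj γ₂) ⟩
      (γ₁ * conj γ₁) * (γ₂ * conj γ₂)    ≡⟨ cong ((γ₁ * conj γ₁) *_) (*-comm γ₂ (conj γ₂)) ⟩
      (γ₁ * conj γ₁) * (conj γ₂ * γ₂)    ≡⟨ *-interchange γ₁ (conj γ₂) (conj γ₁) γ₂ ⟨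
      u * (conj γ₁ * γ₂)                 ≡⟨ cong (u *_) conj-u ⟨
      u * conj u                         ∎)
      where open ≡-Reasoning

    ratio≡u*norm⁻¹ : conj γ₂ * conj γ₁ ⁻¹ ≡ u * norm γ₁ ⁻¹
    ratio≡u*norm⁻¹ = sym (begin
      (γ₁ * conj γ₂) * (γ₁ * conj γ₁) ⁻¹       ≡⟨ cong (u *_) (⁻¹-distrib-* γ₁≢0 (conj-≢0 γ₁≢0)) ⟩
      (γ₁ * conj γ₂) * (γ₁ ⁻¹ * conj γ₁ ⁻¹)    ≡⟨ *-interchange γ₁ (conj γ₂) (γ₁ ⁻¹) (conj γ₁ ⁻¹) ⟩
      (γ₁ * γ₁ ⁻¹) * (conj γ₂ * conj γ₁ ⁻¹)    ≡⟨ cong (_* (conj γ₂ * conj γ₁ ⁻¹)) (inverseʳ γ₁ γ₁≢0) ⟩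
      1# * (conj γ₂ * conj γ₁ ⁻¹)              ≡⟨ *-identityˡ _ ⟩
      conj γ₂ * conj γ₁ ⁻¹                     ∎)
      where open ≡-Reasoning

    capacitance-criterion :
      InGFq (κ γ₁ γ₂) ×
      (IsSquare (conj γ₂ * (conj γ₁ ⁻¹)) ⇔
        ((κ γ₁ γ₂ ≡ 0# × ¬ IsSquareGFq (- 1#)) ⊎ (κ γ₁ γ₂ ≢ 0# × IsSquareGFq (κ γ₁ γ₂))))
    capacitance-criterion rewrite κ≡capacitance | ratio≡u*norm⁻¹ =
      InGFq-capacitance u≢0 ,
      ⇔.trans (square-*⁻¹-GFq⇔ u≢0 (InGFq-norm γ₁) (norm-≢0 γ₁≢0)) (square⇔capacitance u≢0)
      where u≢0 = *-≢0 γ₁≢0 (conj-≢0 γ₂≢0)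

open import Data.Nat using (_^_; _≤_)

lemma4p9 : (p m : ℕ) → Prime p → p ≢ 2 → 1 ≤ m →
  (F : FiniteField ((p ^ m) ℕ.* (p ^ m))) →
  let open FiniteField F
      open GFq² (p ^ m) F
  in (γ₁ γ₂ : Carrier) → γ₁ ≢ 0# → γ₂ ≢ 0# →
     (γ₁ * conj γ₂) - (conj γ₁ * γ₂) ≢ 0# →
     InGFq (κ γ₁ γ₂) ×
     (IsSquare (conj γ₂ * (conj γ₁ ⁻¹)) ⇔
       ((κ γ₁ γ₂ ≡ 0# × ¬ IsSquareGFq (- 1#)) ⊎
        (κ γ₁ γ₂ ≢ 0# × IsSquareGFq (κ γ₁ γ₂))))
lemma4p9 p m p-prime p≢2 _ F γ₁ γ₂ γ₁≢0 γ₂≢0 _ =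
  let k , p≡1+2k = odd-prime p-prime p≢2
      r , [1+2k]^m≡1+2r = odd-^ k m
      q≡1+2r = trans (cong (_^ m) p≡1+2k) [1+2k]^m≡1+2r
  in QuadraticExtension.capacitance-criterion {m = m} p-prime F r q≡1+2r γ₁≢0 γ₂≢0
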